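{- In $\mathbb{F}_3^3$, a maximal $2$-cap has size $5$, i.e. $r(2,\mathbb{F}_3^3)=5$. Moreover, every complete $2$-cap in $\mathbb{F}_3^3$ is maximal, and any two maximal $2$-caps in $\mathbb{F}_3^3$ are affinely equivalent.
   Context: $\mathbb{F}_3^n$ denotes $n$-dimensional affine space over the field with three elements. A subset $C \subseteq \mathbb{F}_3^n$ is a $2$-cap if no three points of $C$ lie on a $1$-dimensional affine subspace and no four points of $C$ lie on a $2$-dimensional affine subspace (equivalently, every subset of $C$ of size at most $4$ is affinely independent). A $2$-cap is complete if it is not a proper subset of another $2$-cap, and maximal if it has the largest possible cardinality; $r(2,\mathbb{F}_3^n)$ denotes this largest cardinality. Two subsets $C,D$ are affinely equivalent if there is an invertible affine transformation $T$ of $\mathbb{F}_3^n$ with $T(C)=D$. -}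

module Defs where

open import Data.Nat using (ℕ; _≤_)
open import Data.Fin using (Fin; zero; suc)
open import Data.Vec using (Vec; zipWith; map; replicate; foldr)
open import Data.List using (List; length)
open import Data.List.Membership.Propositional using (_∈_)
open import Data.List.Relation.Unary.Unique.Propositional using (Unique)
open import Data.Product using (Σ; _×_; ∃)
open import Function.Definitions using (Injective)
open import Relation.Binary.PropositionalEquality using (_≡_)
import Data.List as L

F3 : Set
F3 = Fin 3

infixl 6 _+₃_
infixl 7 _*₃_

_+₃_ : F3 → F3 → F3
zero +₃ y = y
suc zero +₃ zero = suc zero
suc zero +₃ suc zero = suc (suc zero)
suc zero +₃ suc (suc zero) = zero
suc (suc zero) +₃ zero = suc (suc zero)
suc (suc zero) +₃ suc zero = zero
suc (suc zero) +₃ suc (suc zero) = suc zero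

_*₃_ : F3 → F3 → F3
zero *₃ y = zero
suc zero *₃ y = y
suc (suc zero) *₃ zero = zero
suc (suc zero) *₃ suc zero = suc (suc zero)
suc (suc zero) *₃ suc (suc zero) = suc zero

0₃ : F3
0₃ = zero

Pt : ℕ → Set
Pt n = Vec F3 n

zeroV : ∀ {n} → Pt n
zeroV = replicate _ 0₃

_⊕_ : ∀ {n} → Pt n → Pt n → Pt n
_⊕_ = zipWith _+₃_

_·_ : ∀ {n} → F3 → Pt n → Pt n
c · v = map (c *₃_) v

sumF : ∀ {k} → (Fin k → F3) → F3
sumF {ℕ.zero} f = 0₃
sumF {ℕ.suc k} f = f zero +₃ sumF (λ i → f (suc i))

sumV : ∀ {k n} → (Fin k → Pt n) → Pt n
sumV {ℕ.zero} f = zeroV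
sumV {ℕ.suc k} f = f zero ⊕ sumV (λ i → f (suc i))

AffInd : ∀ {n k} → (Fin k → Pt n) → Set
AffInd {n} {k} p =
  ∀ (c : Fin k → F3) → sumF c ≡ 0₃ → sumV (λ i → c i · p i) ≡ zeroV →
  ∀ i → c i ≡ 0₃

-- Finite subsets of F_3^n are duplicate-free lists; cardinality = length.
_⊆_ : ∀ {n} → List (Pt n) → List (Pt n) → Set
C ⊆ D = ∀ {x} → x ∈ C → x ∈ D

-- 2-cap: every subset of size at most 4 is affinely independent.
-- (A subset of size k is given by an injective enumeration Fin k → C.)
TwoCap : ∀ {n} → List (Pt n) → Set
TwoCap {n} C = Unique C ×
  (∀ (k : ℕ) → k ≤ 4 → (p : Fin k → Pt n) → Injective _≡_ _≡_ p →
     (∀ i → p i ∈ C) → AffInd p)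

Complete : ∀ {n} → List (Pt n) → Set
Complete {n} C = TwoCap C × (∀ (D : List (Pt n)) → TwoCap D → C ⊆ D → D ⊆ C)

Maximal : ∀ {n} → List (Pt n) → Set
Maximal {n} C = TwoCap C × (∀ (D : List (Pt n)) → TwoCap D → length D ≤ length C)

Mat : ℕ → Set
Mat n = Vec (Vec F3 n) n

dot : ∀ {n} → Vec F3 n → Vec F3 n → F3
dot u v = foldr _ _+₃_ 0₃ (zipWith _*₃_ u v)

apply : ∀ {n} → Mat n → Pt n → Pt n
apply A v = map (λ row → dot row v) A

Invertible : ∀ {n} → Mat n → Set
Invertible {n} A = Σ (Mat n) λ B →
  (∀ v → apply B (apply A v) ≡ v) × (∀ v → apply A (apply B v) ≡ v)

affine : ∀ {n} → Mat n → Pt n → Pt n → Pt n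
affine A b x = apply A x ⊕ b

AffEquiv : ∀ {n} → List (Pt n) → List (Pt n) → Set
AffEquiv {n} C D = Σ (Mat n) λ A → Σ (Pt n) λ b → Invertible A ×
  (L.map (affine A b) C ⊆ D) × (D ⊆ L.map (affine A b) C)

-- Over F₃ the only minimal affine dependencies among at most four distinct points are
-- a + b + c = 0 (three collinear points) and a + b = c + d (a parallelogram), so a list of
-- distinct points is a 2-cap exactly when it contains neither configuration.  Four points of a
-- cap are affinely independent, so an invertible affine map sends 0, e₁, e₂, e₃ to them.
-- Exhaustive computation over the 27 points shows that exactly five points y make
-- {0, e₁, e₂, e₃, y} a cap, and that any two of them together create a forbidden configuration.
-- Hence a cap has at most five points, every five-point cap is affinely equivalent to
-- {0, e₁, e₂, e₃, (1,1,1)}, and every smaller cap can be enlarged (after completing the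
-- differences of its points to a basis), so complete caps are maximal.
module Submission where

open import Defs
open import Data.Bool using (Bool; T; _∧_)
open import Data.Bool.Properties using (T-∧; T?)
open import Data.Empty using (⊥-elim)
open import Data.Fin as Fin using (Fin; zero; suc; punchIn)
open import Data.Fin.Patterns using (0F; 1F; 2F; 3F)
import Data.Fin.Properties as FinP
open import Data.List as List using (List; []; _∷_; _++_; length)
import Data.List.Properties as ListP
open import Data.List.Membership.Propositional using (_∈_; find; lose)
open import Data.List.Membership.Propositional.Properties using (∈-map⁺; ∈-map⁻; ∈-lookup)
import Data.List.Membership.DecPropositional as DecMembership
open import Data.List.Relation.Binary.Sublist.Propositional as Sublist
  using ([]; _∷_; _∷ʳ_) renaming (_⊆_ to _⊑_)
open import Data.List.Relation.Binary.Sublist.Propositional.Properties using (All-resp-⊆)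
open import Data.List.Relation.Unary.All as All using (All; []; _∷_)
open import Data.List.Relation.Unary.AllPairs using ([]; _∷_)
open import Data.List.Relation.Unary.Any as Any using (Any; here; there)
open import Data.List.Relation.Unary.Unique.Propositional using (Unique)
import Data.List.Relation.Unary.Unique.Propositional.Properties as Unique
open import Data.List.Relation.Unary.Unique.Propositional.Properties using (Unique[x∷xs]⇒x∉xs)
import Data.List.Relation.Unary.Unique.DecPropositional as UniqueDec
open import Data.Nat as ℕ using (zero; suc; _≤_; z≤n; s≤s; _^_)
import Data.Nat.Properties as ℕ
open import Data.Product using (Σ; ∃; _×_; _,_; proj₁; proj₂)
open import Data.Sum using (_⊎_; inj₁; inj₂)
open import Data.Vec as Vec using (Vec; []; _∷_)
open import Data.Vec.N-ary using (N-ary; _$ⁿ_)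
import Data.Vec.Properties as VecP
open import Data.Vec.Properties using (∷-injectiveˡ; ∷-injectiveʳ)
open import Function using (_∘_; id; _⇔_; mk⇔)
open import Function.Bundles using (Equivalence)
open import Function.Definitions using (Injective)
open import Relation.Nullary using (¬_; Dec; yes; no)
open import Relation.Nullary.Decidable
  using (True; isYes; toWitness; map′; ¬?; _→-dec_; _×-dec_; _⊎-dec_)
open import Relation.Unary using (Decidable)
open import Relation.Binary.PropositionalEquality

everywhere : ∀ {n} → (Pt n → Bool) → Bool
everywhere {zero}  b = b []
everywhere {suc n} b = everywhere (b ∘ (0F ∷_)) ∧ everywhere (b ∘ (1F ∷_)) ∧ everywhere (b ∘ (2F ∷_))

everywhere-sound : ∀ {n} (b : Pt n → Bool) → T (everywhere b) → ∀ x → T (b x)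
everywhere-sound {zero}  b t [] = t
everywhere-sound {suc n} b t (a ∷ x) = at a
  where
  parts = Equivalence.to T-∧ t
  rest  = Equivalence.to (T-∧ {everywhere (b ∘ (1F ∷_))}) (proj₂ parts)
  at : ∀ a → T (b (a ∷ x))
  at 0F = everywhere-sound (b ∘ (0F ∷_)) (proj₁ parts) x
  at 1F = everywhere-sound (b ∘ (1F ∷_)) (proj₁ rest) x
  at 2F = everywhere-sound (b ∘ (2F ∷_)) (proj₂ rest) x

byExhaustion : ∀ {n} {P : Pt n → Set} (P? : Decidable P) → {T (everywhere (isYes ∘ P?))} → ∀ x → P x
byExhaustion P? {holds} x = toWitness {a? = P? x} (everywhere-sound (isYes ∘ P?) holds x)

identity : ∀ m (f g : N-ary m F3 F3) → {T (everywhere λ xs → isYes ((f $ⁿ xs) Fin.≟ (g $ⁿ xs)))} →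
           ∀ xs → (f $ⁿ xs) ≡ (g $ⁿ xs)
identity m f g {holds} = byExhaustion (λ xs → (f $ⁿ xs) Fin.≟ (g $ⁿ xs)) {holds}

implication : ∀ m (h k f g : N-ary m F3 F3) →
  {T (everywhere λ xs → isYes ((h $ⁿ xs) Fin.≟ (k $ⁿ xs) →-dec (f $ⁿ xs) Fin.≟ (g $ⁿ xs)))} →
  ∀ xs → (h $ⁿ xs) ≡ (k $ⁿ xs) → (f $ⁿ xs) ≡ (g $ⁿ xs)
implication m h k f g {holds} =
  byExhaustion (λ xs → (h $ⁿ xs) Fin.≟ (k $ⁿ xs) →-dec (f $ⁿ xs) Fin.≟ (g $ⁿ xs)) {holds}

_≟ₚ_ : ∀ {n} (x y : Pt n) → Dec (x ≡ y)
_≟ₚ_ = VecP.≡-dec Fin._≟_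

byExhaustion₂ : ∀ {n} {P : Pt n → Pt n → Set} (P? : ∀ a b → Dec (P a b)) →
                {T (everywhere λ a → everywhere λ b → isYes (P? a b))} → ∀ a b → P a b
byExhaustion₂ P? {holds} a b = toWitness (everywhere-sound _ (everywhere-sound _ holds a) b)

⊕-identityˡ : ∀ {n} (x : Pt n) → zeroV ⊕ x ≡ x
⊕-identityˡ []      = refl
⊕-identityˡ (a ∷ x) = cong (a ∷_) (⊕-identityˡ x)

·-zeroˡ : ∀ {n} (x : Pt n) → 0F · x ≡ zeroV
·-zeroˡ []      = refl
·-zeroˡ (a ∷ x) = cong (0F ∷_) (·-zeroˡ x)

⊕-assoc : ∀ {n} (x y z : Pt n) → (x ⊕ y) ⊕ z ≡ x ⊕ (y ⊕ z)
⊕-assoc [] [] [] = refl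
⊕-assoc (a ∷ x) (b ∷ y) (c ∷ z) =
  cong₂ _∷_ (identity 3 (λ a b c → (a +₃ b) +₃ c) (λ a b c → a +₃ (b +₃ c)) (a ∷ b ∷ c ∷ [])) (⊕-assoc x y z)

⊕-cancelʳ : ∀ {n} (x y w : Pt n) → x ⊕ w ≡ y ⊕ w → x ≡ y
⊕-cancelʳ [] [] [] _ = refl
⊕-cancelʳ (a ∷ x) (b ∷ y) (c ∷ w) eq =
  cong₂ _∷_ (implication 3 (λ a b c → a +₃ c) (λ a b c → b +₃ c) (λ a b c → a) (λ a b c → b)
                           (a ∷ b ∷ c ∷ []) (∷-injectiveˡ eq))
            (⊕-cancelʳ x y w (∷-injectiveʳ eq))

infixl 6 _⊖_
_⊖_ : ∀ {n} → Pt n → Pt n → Pt n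
x ⊖ y = x ⊕ (2F · y)

⊖-self : ∀ {n} (x : Pt n) → x ⊖ x ≡ zeroV
⊖-self [] = refl
⊖-self (a ∷ x) = cong₂ _∷_ (identity 1 (λ a → a +₃ 2F *₃ a) (λ _ → 0F) (a ∷ [])) (⊖-self x)

⊖≡zero⇒≡ : ∀ {n} (x y : Pt n) → x ⊖ y ≡ zeroV → x ≡ y
⊖≡zero⇒≡ [] [] _ = refl
⊖≡zero⇒≡ (a ∷ x) (b ∷ y) eq =
  cong₂ _∷_ (implication 2 (λ a b → a +₃ 2F *₃ b) (λ _ _ → 0F) (λ a b → a) (λ a b → b)
                           (a ∷ b ∷ []) (∷-injectiveˡ eq))
            (⊖≡zero⇒≡ x y (∷-injectiveʳ eq))

⊕-⊖-cancel : ∀ {n} (x w : Pt n) → (x ⊕ w) ⊖ w ≡ x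
⊕-⊖-cancel [] [] = refl
⊕-⊖-cancel (a ∷ x) (b ∷ w) =
  cong₂ _∷_ (identity 2 (λ a b → (a +₃ b) +₃ 2F *₃ b) (λ a b → a) (a ∷ b ∷ [])) (⊕-⊖-cancel x w)

⊖-⊕-cancel : ∀ {n} (x w : Pt n) → (x ⊖ w) ⊕ w ≡ x
⊖-⊕-cancel [] [] = refl
⊖-⊕-cancel (a ∷ x) (b ∷ w) =
  cong₂ _∷_ (identity 2 (λ a b → (a +₃ 2F *₃ b) +₃ b) (λ a b → a) (a ∷ b ∷ [])) (⊖-⊕-cancel x w)

-- Uses o ⊕ o ⊕ o ≡ zeroV (characteristic 3).
translate₃ : ∀ {n} (x y z o : Pt n) → (x ⊕ o) ⊕ ((y ⊕ o) ⊕ (z ⊕ o)) ≡ x ⊕ (y ⊕ z)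
translate₃ [] [] [] [] = refl
translate₃ (a ∷ x) (b ∷ y) (c ∷ z) (d ∷ o) =
  cong₂ _∷_ (identity 4 (λ a b c d → (a +₃ d) +₃ ((b +₃ d) +₃ (c +₃ d))) (λ a b c d → a +₃ (b +₃ c))
                        (a ∷ b ∷ c ∷ d ∷ []))
            (translate₃ x y z o)

translate₂ : ∀ {n} (x y o : Pt n) → (x ⊕ o) ⊕ (y ⊕ o) ≡ (x ⊕ y) ⊕ (o ⊕ o)
translate₂ [] [] [] = refl
translate₂ (a ∷ x) (b ∷ y) (d ∷ o) =
  cong₂ _∷_ (identity 3 (λ a b d → (a +₃ d) +₃ (b +₃ d)) (λ a b d → (a +₃ b) +₃ (d +₃ d)) (a ∷ b ∷ d ∷ []))
            (translate₂ x y o)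

Collinear : ∀ {n} → Pt n → Pt n → Pt n → Set
Collinear a b c = a ⊕ (b ⊕ c) ≡ zeroV

Parallelogram : ∀ {n} → Pt n → Pt n → Pt n → Pt n → Set
Parallelogram a b c d = a ⊕ b ≡ c ⊕ d

data Obstruction {n} (C : List (Pt n)) : Set where
  collinear     : ∀ {a b c} → Unique (a ∷ b ∷ c ∷ []) → (a ∷ b ∷ c ∷ []) ⊆ C →
                  Collinear a b c → Obstruction C
  parallelogram : ∀ {a b c d} → Unique (a ∷ b ∷ c ∷ d ∷ []) → (a ∷ b ∷ c ∷ d ∷ []) ⊆ C →
                  Parallelogram a b c d → Obstruction C

Obstruction-mono : ∀ {n} {C D : List (Pt n)} → C ⊆ D → Obstruction C → Obstruction D
Obstruction-mono C⊆D (collinear u S⊆C col)     = collinear u (C⊆D ∘ S⊆C) col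
Obstruction-mono C⊆D (parallelogram u S⊆C par) = parallelogram u (C⊆D ∘ S⊆C) par

collinear-differences : ∀ {n} (x₁ x₂ x₃ : Pt n) → (x₂ ⊖ x₁) ⊕ (x₃ ⊖ x₁) ≡ zeroV → Collinear x₁ x₂ x₃
collinear-differences [] [] [] _ = refl
collinear-differences (a ∷ x₁) (b ∷ x₂) (c ∷ x₃) eq =
  cong₂ _∷_ (implication 3 (λ a b c → (b +₃ 2F *₃ a) +₃ (c +₃ 2F *₃ a)) (λ _ _ _ → 0F)
                           (λ a b c → a +₃ (b +₃ c)) (λ _ _ _ → 0F) (a ∷ b ∷ c ∷ []) (∷-injectiveˡ eq))
            (collinear-differences x₁ x₂ x₃ (∷-injectiveʳ eq))

obstruction? : ∀ {n} (C : List (Pt n)) → Dec (Obstruction C)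
obstruction? C = map′ from to
  (Any.any? (λ a → Any.any? (λ b → Any.any? (λ c → collinear? a b c) C) C) C ⊎-dec
   Any.any? (λ a → Any.any? (λ b → Any.any? (λ c → Any.any? (λ d → parallelogram? a b c d) C) C) C) C)
  where
  collinear? : ∀ a b c → Dec (Unique (a ∷ b ∷ c ∷ []) × Collinear a b c)
  collinear? a b c = UniqueDec.unique? _≟ₚ_ _ ×-dec (_ ≟ₚ _)
  parallelogram? : ∀ a b c d → Dec (Unique (a ∷ b ∷ c ∷ d ∷ []) × Parallelogram a b c d)
  parallelogram? a b c d = UniqueDec.unique? _≟ₚ_ _ ×-dec (_ ≟ₚ _)
  from : _ → Obstruction C
  from (inj₁ found) with find found
  ... | a , a∈ , found with find found
  ... | b , b∈ , found with find found
  ... | c , c∈ , (u , col) = collinear u (All.lookup (a∈ ∷ b∈ ∷ c∈ ∷ [])) col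
  from (inj₂ found) with find found
  ... | a , a∈ , found with find found
  ... | b , b∈ , found with find found
  ... | c , c∈ , found with find found
  ... | d , d∈ , (u , par) = parallelogram u (All.lookup (a∈ ∷ b∈ ∷ c∈ ∷ d∈ ∷ [])) par
  to : Obstruction C → _
  to (collinear u S⊆C col) =
    inj₁ (lose (S⊆C (here refl)) (lose (S⊆C (there (here refl)))
         (lose (S⊆C (there (there (here refl)))) (u , col))))
  to (parallelogram u S⊆C par) =
    inj₂ (lose (S⊆C (here refl)) (lose (S⊆C (there (here refl)))
         (lose (S⊆C (there (there (here refl)))) (lose (S⊆C (there (there (there (here refl))))) (u , par)))))

Dependency : ∀ {n k} → (Fin k → Pt n) → (Fin k → F3) → Set
Dependency p c = sumF c ≡ 0₃ × sumV (λ i → c i · p i) ≡ zeroV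

sumF-punchIn : ∀ {k} (c : Fin (suc k) → F3) i → c i ≡ 0F → sumF c ≡ sumF (c ∘ punchIn i)
sumF-punchIn c zero ci≡0 = cong (_+₃ sumF (c ∘ suc)) ci≡0
sumF-punchIn {suc k} c (suc i) ci≡0 = cong (c zero +₃_) (sumF-punchIn (c ∘ suc) i ci≡0)

sumV-punchIn : ∀ {n k} (f : Fin (suc k) → Pt n) i → f i ≡ zeroV → sumV f ≡ sumV (f ∘ punchIn i)
sumV-punchIn f zero fi≡0 = trans (cong (_⊕ sumV (f ∘ suc)) fi≡0) (⊕-identityˡ _)
sumV-punchIn {k = suc k} f (suc i) fi≡0 = cong (f zero ⊕_) (sumV-punchIn (f ∘ suc) i fi≡0)

Dependency-punchIn : ∀ {n k} {p : Fin (suc k) → Pt n} {c} i → c i ≡ 0F →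
                     Dependency p c → Dependency (p ∘ punchIn i) (c ∘ punchIn i)
Dependency-punchIn {p = p} {c} i ci≡0 (Σc , Σcp) =
  trans (sym (sumF-punchIn c i ci≡0)) Σc ,
  trans (sym (sumV-punchIn (λ j → c j · p j) i (trans (cong (_· p i) ci≡0) (·-zeroˡ (p i))))) Σcp

FullSupport : ∀ {k} → (Fin k → F3) → Set
FullSupport c = ∀ i → c i ≢ 0F

-- A dependency with a zero coefficient is a dependency of the family with that point removed.
affInd-fromMinors : ∀ {n k} {p : Fin (suc k) → Pt n} → (∀ i → AffInd (p ∘ punchIn i)) →
                    (∀ c → Dependency p c → ¬ FullSupport c) → AffInd p
affInd-fromMinors {p = p} minors noFull c Σc Σcp i with FinP.any? (λ j → c j Fin.≟ 0F)
... | no noZero = ⊥-elim (noFull c (Σc , Σcp) λ j cj≡0 → noZero (j , cj≡0))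
... | yes (j , cj≡0) with i Fin.≟ j
...   | yes refl = cj≡0
...   | no i≢j   = subst (λ m → c m ≡ 0F) (FinP.punchIn-punchOut j≢i)
                     (minors j (c ∘ punchIn j) (proj₁ minor) (proj₂ minor) (Fin.punchOut j≢i))
  where
  j≢i = i≢j ∘ sym
  minor = Dependency-punchIn {p = p} {c} j cj≡0 (Σc , Σcp)

singleCoefficient : ∀ c → c ≢ 0F → c +₃ 0F ≢ 0F
singleCoefficient 0F c≢0 _ = c≢0 refl
singleCoefficient 1F _ ()
singleCoefficient 2F _ ()

PairFact : Pt 4 → Set
PairFact (c₀ ∷ c₁ ∷ x₀ ∷ x₁ ∷ []) =
  c₀ ≢ 0F → c₀ +₃ (c₁ +₃ 0F) ≡ 0F → c₀ *₃ x₀ +₃ (c₁ *₃ x₁ +₃ 0F) ≡ 0F → x₀ ≡ x₁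

pairFact? : Decidable PairFact
pairFact? (c₀ ∷ c₁ ∷ x₀ ∷ x₁ ∷ []) = ¬? (_ Fin.≟ _) →-dec (_ Fin.≟ _) →-dec (_ Fin.≟ _) →-dec (_ Fin.≟ _)

TripleFact : Pt 6 → Set
TripleFact (c₀ ∷ c₁ ∷ c₂ ∷ x₀ ∷ x₁ ∷ x₂ ∷ []) =
  c₀ ≢ 0F → c₁ ≢ 0F → c₂ ≢ 0F → c₀ +₃ (c₁ +₃ (c₂ +₃ 0F)) ≡ 0F →
  c₀ *₃ x₀ +₃ (c₁ *₃ x₁ +₃ (c₂ *₃ x₂ +₃ 0F)) ≡ 0F → x₀ +₃ (x₁ +₃ x₂) ≡ 0F

tripleFact? : Decidable TripleFact
tripleFact? (c₀ ∷ c₁ ∷ c₂ ∷ x₀ ∷ x₁ ∷ x₂ ∷ []) =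
  ¬? (_ Fin.≟ _) →-dec ¬? (_ Fin.≟ _) →-dec ¬? (_ Fin.≟ _) →-dec (_ Fin.≟ _) →-dec
  (_ Fin.≟ _) →-dec (_ Fin.≟ _)

PairingFact : Pt 4 → Set
PairingFact (c₀ ∷ c₁ ∷ c₂ ∷ c₃ ∷ []) =
  c₀ ≢ 0F → c₁ ≢ 0F → c₂ ≢ 0F → c₃ ≢ 0F → c₀ +₃ (c₁ +₃ (c₂ +₃ (c₃ +₃ 0F))) ≡ 0F →
  c₀ ≡ c₁ ⊎ c₀ ≡ c₂ ⊎ c₀ ≡ c₃

pairingFact? : Decidable PairingFact
pairingFact? (c₀ ∷ c₁ ∷ c₂ ∷ c₃ ∷ []) =
  ¬? (_ Fin.≟ _) →-dec ¬? (_ Fin.≟ _) →-dec ¬? (_ Fin.≟ _) →-dec ¬? (_ Fin.≟ _) →-dec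
  (_ Fin.≟ _) →-dec ((_ Fin.≟ _) ⊎-dec (_ Fin.≟ _) ⊎-dec (_ Fin.≟ _))

QuadFact : Pt 8 → Set
QuadFact (c₀ ∷ c₁ ∷ c₂ ∷ c₃ ∷ x₀ ∷ x₁ ∷ x₂ ∷ x₃ ∷ []) =
  c₀ ≢ 0F → c₁ ≢ 0F → c₂ ≢ 0F → c₃ ≢ 0F → c₀ +₃ (c₁ +₃ (c₂ +₃ (c₃ +₃ 0F))) ≡ 0F →
  c₀ *₃ x₀ +₃ (c₁ *₃ x₁ +₃ (c₂ *₃ x₂ +₃ (c₃ *₃ x₃ +₃ 0F))) ≡ 0F →
  (c₀ ≡ c₁ → x₀ +₃ x₁ ≡ x₂ +₃ x₃) × (c₀ ≡ c₂ → x₀ +₃ x₂ ≡ x₁ +₃ x₃) × (c₀ ≡ c₃ → x₀ +₃ x₃ ≡ x₁ +₃ x₂)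

quadFact? : Decidable QuadFact
quadFact? (c₀ ∷ c₁ ∷ c₂ ∷ c₃ ∷ x₀ ∷ x₁ ∷ x₂ ∷ x₃ ∷ []) =
  ¬? (_ Fin.≟ _) →-dec ¬? (_ Fin.≟ _) →-dec ¬? (_ Fin.≟ _) →-dec ¬? (_ Fin.≟ _) →-dec
  (_ Fin.≟ _) →-dec (_ Fin.≟ _) →-dec
  ((_ Fin.≟ _) →-dec (_ Fin.≟ _)) ×-dec ((_ Fin.≟ _) →-dec (_ Fin.≟ _)) ×-dec ((_ Fin.≟ _) →-dec (_ Fin.≟ _))

pair-dependency : ∀ {n} (c : Fin 2 → F3) (a b : Pt n) → FullSupport c → sumF c ≡ 0F →
                  (c 0F · a) ⊕ ((c 1F · b) ⊕ zeroV) ≡ zeroV → a ≡ b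
pair-dependency c [] [] _ _ _ = refl
pair-dependency c (x₀ ∷ a) (x₁ ∷ b) full Σc eq =
  cong₂ _∷_ (byExhaustion pairFact? (c 0F ∷ c 1F ∷ x₀ ∷ x₁ ∷ []) (full 0F) Σc (∷-injectiveˡ eq))
            (pair-dependency c a b full Σc (∷-injectiveʳ eq))

triple-dependency : ∀ {n} (c : Fin 3 → F3) (a b d : Pt n) → FullSupport c → sumF c ≡ 0F →
                    (c 0F · a) ⊕ ((c 1F · b) ⊕ ((c 2F · d) ⊕ zeroV)) ≡ zeroV → Collinear a b d
triple-dependency c [] [] [] _ _ _ = refl
triple-dependency c (x₀ ∷ a) (x₁ ∷ b) (x₂ ∷ d) full Σc eq =
  cong₂ _∷_ (byExhaustion tripleFact? (c 0F ∷ c 1F ∷ c 2F ∷ x₀ ∷ x₁ ∷ x₂ ∷ [])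
               (full 0F) (full 1F) (full 2F) Σc (∷-injectiveˡ eq))
            (triple-dependency c a b d full Σc (∷-injectiveʳ eq))

-- Four nonzero coefficients with sum 0 are two equal ones and two opposite ones.
pairing : (c : Fin 4 → F3) → FullSupport c → sumF c ≡ 0F → c 0F ≡ c 1F ⊎ c 0F ≡ c 2F ⊎ c 0F ≡ c 3F
pairing c full =
  byExhaustion pairingFact? (c 0F ∷ c 1F ∷ c 2F ∷ c 3F ∷ []) (full 0F) (full 1F) (full 2F) (full 3F)

quad-dependency : ∀ {n} (c : Fin 4 → F3) (a b d e : Pt n) → FullSupport c → sumF c ≡ 0F →
  (c 0F · a) ⊕ ((c 1F · b) ⊕ ((c 2F · d) ⊕ ((c 3F · e) ⊕ zeroV))) ≡ zeroV →
  (c 0F ≡ c 1F → Parallelogram a b d e) × (c 0F ≡ c 2F → Parallelogram a d b e) ×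
  (c 0F ≡ c 3F → Parallelogram a e b d)
quad-dependency c [] [] [] [] _ _ _ = (λ _ → refl) , (λ _ → refl) , (λ _ → refl)
quad-dependency c (x₀ ∷ a) (x₁ ∷ b) (x₂ ∷ d) (x₃ ∷ e) full Σc eq
  with byExhaustion quadFact? (c 0F ∷ c 1F ∷ c 2F ∷ c 3F ∷ x₀ ∷ x₁ ∷ x₂ ∷ x₃ ∷ [])
         (full 0F) (full 1F) (full 2F) (full 3F) Σc (∷-injectiveˡ eq)
     | quad-dependency c a b d e full Σc (∷-injectiveʳ eq)
... | h₁ , h₂ , h₃ | t₁ , t₂ , t₃ = ∷-when h₁ t₁ , ∷-when h₂ t₂ , ∷-when h₃ t₃
  where
  ∷-when : ∀ {P : Set} {m} {x y} {xs ys : Pt m} → (P → x ≡ y) → (P → xs ≡ ys) → P → x ∷ xs ≡ y ∷ ys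
  ∷-when h t p = cong₂ _∷_ (h p) (t p)

module _ {n k} {p : Fin k → Pt n} where

  image-unique : Injective _≡_ _≡_ p → (is : List (Fin k)) →
                 {True (UniqueDec.unique? Fin._≟_ is)} → Unique (List.map p is)
  image-unique inj is {distinct} = Unique.map⁺ inj (toWitness distinct)

  image-⊆ : ∀ {C} → (∀ i → p i ∈ C) → (is : List (Fin k)) → List.map p is ⊆ C
  image-⊆ p∈C is x∈ with ∈-map⁻ p x∈
  ... | i , _ , refl = p∈C i

noFullSupport : ∀ {n k} {C : List (Pt n)} → ¬ Obstruction C → suc k ≤ 4 →
  (p : Fin (suc k) → Pt n) → Injective _≡_ _≡_ p → (∀ i → p i ∈ C) →
  ∀ c → Dependency p c → ¬ FullSupport c
noFullSupport {k = 0} _ _ p _ _ c (Σc , _) full = singleCoefficient (c 0F) (full 0F) Σc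
noFullSupport {k = 1} _ _ p inj _ c (Σc , Σcp) full with inj (pair-dependency c (p 0F) (p 1F) full Σc Σcp)
... | ()
noFullSupport {k = 2} free _ p inj p∈C c (Σc , Σcp) full =
  free (collinear (image-unique inj (0F ∷ 1F ∷ 2F ∷ [])) (image-⊆ p∈C _)
                  (triple-dependency c (p 0F) (p 1F) (p 2F) full Σc Σcp))
noFullSupport {k = 3} free _ p inj p∈C c (Σc , Σcp) full
  with pairing c full Σc | quad-dependency c (p 0F) (p 1F) (p 2F) (p 3F) full Σc Σcp
... | inj₁ c₀≡c₁         | par , _ , _ =
  free (parallelogram (image-unique inj (0F ∷ 1F ∷ 2F ∷ 3F ∷ [])) (image-⊆ p∈C _) (par c₀≡c₁))
... | inj₂ (inj₁ c₀≡c₂)  | _ , par , _ =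
  free (parallelogram (image-unique inj (0F ∷ 2F ∷ 1F ∷ 3F ∷ [])) (image-⊆ p∈C _) (par c₀≡c₂))
... | inj₂ (inj₂ c₀≡c₃)  | _ , _ , par =
  free (parallelogram (image-unique inj (0F ∷ 3F ∷ 1F ∷ 2F ∷ [])) (image-⊆ p∈C _) (par c₀≡c₃))
noFullSupport {k = suc (suc (suc (suc _)))} _ (s≤s (s≤s (s≤s (s≤s ()))))

noObstruction⇒twoCap : ∀ {n} {C : List (Pt n)} → Unique C → ¬ Obstruction C → TwoCap C
noObstruction⇒twoCap {n} {C} unique free = unique , λ _ → independent
  where
  independent : ∀ {k} → k ≤ 4 → (p : Fin k → Pt n) → Injective _≡_ _≡_ p → (∀ i → p i ∈ C) → AffInd p
  independent {zero}  _   _ _   _   _ _ _ ()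
  independent {suc k} k<4 p inj p∈C = affInd-fromMinors {p = p}
    (λ i → independent (ℕ.<⇒≤ k<4) (p ∘ punchIn i) (FinP.punchIn-injective i _ _ ∘ inj) (p∈C ∘ punchIn i))
    (noFullSupport free k<4 p inj p∈C)

lookup-injective : ∀ {A : Set} {xs : List A} → Unique xs → Injective _≡_ _≡_ (List.lookup xs)
lookup-injective {xs = x ∷ xs} u       {zero}  {zero}  _  = refl
lookup-injective {xs = x ∷ xs} u       {zero}  {suc j} eq =
  ⊥-elim (Unique[x∷xs]⇒x∉xs u (subst (_∈ xs) (sym eq) (∈-lookup j)))
lookup-injective {xs = x ∷ xs} u       {suc i} {zero}  eq =
  ⊥-elim (Unique[x∷xs]⇒x∉xs u (subst (_∈ xs) eq (∈-lookup i)))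
lookup-injective {xs = x ∷ xs} (_ ∷ u) {suc i} {suc j} eq = cong suc (lookup-injective u eq)

collinear-dependency : ∀ {n} (a b c : Pt n) → Collinear a b c →
                       (1F · a) ⊕ ((1F · b) ⊕ ((1F · c) ⊕ zeroV)) ≡ zeroV
collinear-dependency [] [] [] _ = refl
collinear-dependency (x ∷ a) (y ∷ b) (z ∷ c) eq =
  cong₂ _∷_ (implication 3 (λ x y z → x +₃ (y +₃ z)) (λ _ _ _ → 0F)
                           (λ x y z → x +₃ (y +₃ (z +₃ 0F))) (λ _ _ _ → 0F)
                           (x ∷ y ∷ z ∷ []) (∷-injectiveˡ eq))
            (collinear-dependency a b c (∷-injectiveʳ eq))

parallelogram-dependency : ∀ {n} (a b c d : Pt n) → Parallelogram a b c d →
                           (1F · a) ⊕ ((1F · b) ⊕ ((2F · c) ⊕ ((2F · d) ⊕ zeroV))) ≡ zeroV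
parallelogram-dependency [] [] [] [] _ = refl
parallelogram-dependency (x ∷ a) (y ∷ b) (z ∷ c) (w ∷ d) eq =
  cong₂ _∷_ (implication 4 (λ x y z w → x +₃ y) (λ x y z w → z +₃ w)
                           (λ x y z w → x +₃ (y +₃ (2F *₃ z +₃ (2F *₃ w +₃ 0F)))) (λ _ _ _ _ → 0F)
                           (x ∷ y ∷ z ∷ w ∷ []) (∷-injectiveˡ eq))
            (parallelogram-dependency a b c d (∷-injectiveʳ eq))

twoCap⇒noObstruction : ∀ {n} {C : List (Pt n)} → TwoCap C → ¬ Obstruction C
twoCap⇒noObstruction (_ , indep) (collinear {a} {b} {c} u S⊆C col)
  with indep 3 (s≤s (s≤s (s≤s z≤n))) _ (lookup-injective u) (S⊆C ∘ ∈-lookup)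
             (λ _ → 1F) refl (collinear-dependency a b c col) 0F
... | ()
twoCap⇒noObstruction (_ , indep) (parallelogram {a} {b} {c} {d} u S⊆C par)
  with indep 4 ℕ.≤-refl _ (lookup-injective u) (S⊆C ∘ ∈-lookup)
             (λ { 0F → 1F ; 1F → 1F ; _ → 2F }) refl (parallelogram-dependency a b c d par) 0F
... | ()

Unique-resp-⊑ : ∀ {A : Set} {xs ys : List A} → xs ⊑ ys → Unique ys → Unique xs
Unique-resp-⊑ []              []        = []
Unique-resp-⊑ (_ ∷ʳ xs⊑ys)    (_ ∷ u)   = Unique-resp-⊑ xs⊑ys u
Unique-resp-⊑ (refl ∷ xs⊑ys)  (y∉ ∷ u)  = All-resp-⊆ xs⊑ys y∉ ∷ Unique-resp-⊑ xs⊑ys u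

twoCap-independent : ∀ {n} {D S : List (Pt n)} → TwoCap D → length S ≤ 4 → Unique S → S ⊆ D →
                     AffInd (List.lookup S)
twoCap-independent (_ , independent) |S|≤4 u S⊆D =
  independent _ |S|≤4 _ (lookup-injective u) (S⊆D ∘ ∈-lookup)

prefix-independent : ∀ {n} {x₁ x₂ x₃ x₄ : Pt n} {rest} → TwoCap (x₁ ∷ x₂ ∷ x₃ ∷ x₄ ∷ rest) →
                     AffInd (List.lookup (x₁ ∷ x₂ ∷ x₃ ∷ x₄ ∷ []))
prefix-independent cap@(unique , _) =
  twoCap-independent cap ℕ.≤-refl (Unique-resp-⊑ prefix unique) (Sublist.lookup prefix)
  where prefix = refl ∷ refl ∷ refl ∷ refl ∷ Sublist.minimum _

Linear : ∀ {n} → (Pt n → Pt n) → Set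
Linear g = (∀ u v → g (u ⊕ v) ≡ g u ⊕ g v) × (∀ c v → g (c · v) ≡ c · g v)

linear-zero : ∀ {n} {g : Pt n → Pt n} → Linear g → g zeroV ≡ zeroV
linear-zero {g = g} (_ , homogeneous) =
  trans (cong g (sym (·-zeroˡ zeroV))) (trans (homogeneous 0F zeroV) (·-zeroˡ _))

linear-injective : ∀ {n} {g : Pt n → Pt n} → Linear g → (∀ x → g x ≡ zeroV → x ≡ zeroV) →
                   Injective _≡_ _≡_ g
linear-injective {g = g} (additive , homogeneous) kernel {x} {y} gx≡gy =
  ⊖≡zero⇒≡ x y (kernel _ (begin
    g (x ⊖ y)            ≡⟨ additive x (2F · y) ⟩
    g x ⊕ g (2F · y)     ≡⟨ cong₂ _⊕_ gx≡gy (homogeneous 2F y) ⟩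
    g y ⊖ g y            ≡⟨ ⊖-self (g y) ⟩
    zeroV                ∎))
  where open ≡-Reasoning

linear-∘ : ∀ {n} {g h : Pt n → Pt n} → Linear g → Linear h → Linear (g ∘ h)
linear-∘ {g = g} (g-add , g-hom) (h-add , h-hom) =
  (λ u v → trans (cong g (h-add u v)) (g-add _ _)) , (λ c v → trans (cong g (h-hom c v)) (g-hom _ _))

dot-⊕ : ∀ {n} (r u v : Pt n) → dot r (u ⊕ v) ≡ dot r u +₃ dot r v
dot-⊕ [] [] [] = refl
dot-⊕ (a ∷ r) (x ∷ u) (y ∷ v) =
  trans (cong (a *₃ (x +₃ y) +₃_) (dot-⊕ r u v))
        (identity 5 (λ a x y s t → a *₃ (x +₃ y) +₃ (s +₃ t)) (λ a x y s t → (a *₃ x +₃ s) +₃ (a *₃ y +₃ t))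
                    (a ∷ x ∷ y ∷ dot r u ∷ dot r v ∷ []))

dot-· : ∀ {n} (r : Pt n) c v → dot r (c · v) ≡ c *₃ dot r v
dot-· [] c [] = identity 1 (λ _ → 0F) (λ c → c *₃ 0F) (c ∷ [])
dot-· (a ∷ r) c (x ∷ v) =
  trans (cong (a *₃ (c *₃ x) +₃_) (dot-· r c v))
        (identity 4 (λ a c x s → a *₃ (c *₃ x) +₃ c *₃ s) (λ a c x s → c *₃ (a *₃ x +₃ s))
                    (a ∷ c ∷ x ∷ dot r v ∷ []))

apply-linear : ∀ {n} (A : Mat n) → Linear (apply A)
apply-linear A = (λ u v → rows-⊕ A u v) , (λ c v → rows-· A c v)
  where
  rows-⊕ : ∀ {m n} (rows : Vec (Pt n) m) u v →
           Vec.map (λ r → dot r (u ⊕ v)) rows ≡ Vec.map (λ r → dot r u) rows ⊕ Vec.map (λ r → dot r v) rows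
  rows-⊕ []       u v = refl
  rows-⊕ (r ∷ rs) u v = cong₂ _∷_ (dot-⊕ r u v) (rows-⊕ rs u v)
  rows-· : ∀ {m n} (rows : Vec (Pt n) m) c v →
           Vec.map (λ r → dot r (c · v)) rows ≡ c · Vec.map (λ r → dot r v) rows
  rows-· []       c v = refl
  rows-· (r ∷ rs) c v = cong₂ _∷_ (dot-· r c v) (rows-· rs c v)

inverse-linear : ∀ {n} {g h : Pt n → Pt n} → Linear g → Injective _≡_ _≡_ g → (∀ y → g (h y) ≡ y) → Linear h
inverse-linear (additive , homogeneous) inj section =
  (λ u v → inj (trans (section _) (sym (trans (additive _ _) (cong₂ _⊕_ (section u) (section v)))))) ,
  (λ c v → inj (trans (section _) (sym (trans (homogeneous _ _) (cong (c ·_) (section v))))))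

nonsingular : ∀ {n} → Mat n → Bool
nonsingular M = everywhere λ x → isYes (apply M x ≟ₚ zeroV →-dec x ≟ₚ zeroV)

nonsingular-injective : ∀ {n} (M : Mat n) → T (nonsingular M) → Injective _≡_ _≡_ (apply M)
nonsingular-injective M holds =
  linear-injective (apply-linear M) λ x → toWitness (everywhere-sound _ holds x)

injective⇒surjective : ∀ {N} (h : Fin N → Fin N) → Injective _≡_ _≡_ h → ∀ y → ∃ λ x → h x ≡ y
injective⇒surjective {suc N} h inj y with FinP.any? (λ x → h x Fin.≟ y)
... | yes found = found
... | no missed = ⊥-elim (FinP.<⇒notInjective (ℕ.n<1+n N) h′-injective)
  where
  y≢h : ∀ x → y ≢ h x
  y≢h x y≡hx = missed (x , sym y≡hx)
  h′-injective : Injective _≡_ _≡_ (λ x → Fin.punchOut (y≢h x))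
  h′-injective eq = inj (FinP.punchOut-injective (y≢h _) (y≢h _) eq)

encode : ∀ {n} → Pt n → Fin (3 ^ n)
encode = Fin.funToFin ∘ Vec.lookup

decode : ∀ {n} → Fin (3 ^ n) → Pt n
decode = Vec.tabulate ∘ Fin.finToFun

funToFin-cong : ∀ {m k} {f g : Fin m → Fin k} → (∀ i → f i ≡ g i) → Fin.funToFin f ≡ Fin.funToFin g
funToFin-cong {zero}  _   = refl
funToFin-cong {suc m} f≗g = cong₂ Fin.combine (f≗g zero) (funToFin-cong (f≗g ∘ suc))

decode-encode : ∀ {n} (x : Pt n) → decode (encode x) ≡ x
decode-encode x =
  trans (VecP.tabulate-cong (FinP.finToFun-funToFin (Vec.lookup x))) (VecP.tabulate∘lookup x)

encode-decode : ∀ n (i : Fin (3 ^ n)) → encode {n} (decode i) ≡ i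
encode-decode n i =
  trans (funToFin-cong {n} (VecP.lookup∘tabulate (Fin.finToFun i))) (FinP.funToFin-finToFin {n} i)

surjective : ∀ {n} (f : Pt n → Pt n) → Injective _≡_ _≡_ f → ∀ y → ∃ λ x → f x ≡ y
surjective {n} f inj y
  with injective⇒surjective (encode ∘ f ∘ decode) (decode-injective ∘ inj ∘ encode-injective) (encode y)
  where
  encode-injective : ∀ {x y : Pt n} → encode x ≡ encode y → x ≡ y
  encode-injective {x} {y} eq = trans (sym (decode-encode x)) (trans (cong decode eq) (decode-encode y))
  decode-injective : ∀ {i j} → decode {n} i ≡ decode j → i ≡ j
  decode-injective {i} {j} eq = trans (sym (encode-decode n i)) (trans (cong encode eq) (encode-decode n j))
... | i , eq = decode i , trans (sym (decode-encode _)) (trans (cong decode eq) (decode-encode y))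

map-⊆ : ∀ {n} (F : Pt n → Pt n) {S X : List (Pt n)} → S ⊆ X → List.map F S ⊆ List.map F X
map-⊆ F S⊆X x∈ with ∈-map⁻ F x∈
... | _ , s∈ , refl = ∈-map⁺ F (S⊆X s∈)

module AffineImage {n} (A : Mat n) (o : Pt n) (A-injective : Injective _≡_ _≡_ (apply A)) where

  F : Pt n → Pt n
  F = affine A o

  F-injective : Injective _≡_ _≡_ F
  F-injective eq = A-injective (⊕-cancelʳ _ _ o eq)

  private
    additive = proj₁ (apply-linear A)

    sum₃ : ∀ x y z → F x ⊕ (F y ⊕ F z) ≡ apply A (x ⊕ (y ⊕ z))
    sum₃ x y z = trans (translate₃ (apply A x) (apply A y) (apply A z) o)
                       (sym (trans (additive x _) (cong (apply A x ⊕_) (additive y z))))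

    sum₂ : ∀ x y → F x ⊕ F y ≡ apply A (x ⊕ y) ⊕ (o ⊕ o)
    sum₂ x y = trans (translate₂ (apply A x) (apply A y) o) (cong (_⊕ (o ⊕ o)) (sym (additive x y)))

    A-zero = linear-zero (apply-linear A)

  collinear-image : ∀ x y z → Collinear x y z ⇔ Collinear (F x) (F y) (F z)
  collinear-image x y z = mk⇔
    (λ col → trans (sum₃ x y z) (trans (cong (apply A) col) A-zero))
    (λ col → A-injective (trans (sym (sum₃ x y z)) (trans col (sym A-zero))))

  parallelogram-image : ∀ x y z w → Parallelogram x y z w ⇔ Parallelogram (F x) (F y) (F z) (F w)
  parallelogram-image x y z w = mk⇔
    (λ par → trans (sum₂ x y) (trans (cong (λ v → apply A v ⊕ (o ⊕ o)) par) (sym (sum₂ z w))))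
    (λ par → A-injective (⊕-cancelʳ _ _ (o ⊕ o) (trans (sym (sum₂ x y)) (trans par (sum₂ z w)))))

  obstruction-image : ∀ X → Obstruction X ⇔ Obstruction (List.map F X)
  obstruction-image X = mk⇔ forward backward
    where
    forward : Obstruction X → Obstruction (List.map F X)
    forward (collinear {a} {b} {c} u S⊆X col) =
      collinear (Unique.map⁺ F-injective u) (map-⊆ F S⊆X) (Equivalence.to (collinear-image a b c) col)
    forward (parallelogram {a} {b} {c} {d} u S⊆X par) =
      parallelogram (Unique.map⁺ F-injective u) (map-⊆ F S⊆X)
                    (Equivalence.to (parallelogram-image a b c d) par)
    backward : Obstruction (List.map F X) → Obstruction X
    backward (collinear u S⊆FX col)
      with ∈-map⁻ F (S⊆FX (here refl)) | ∈-map⁻ F (S⊆FX (there (here refl)))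
         | ∈-map⁻ F (S⊆FX (there (there (here refl))))
    ... | a , a∈ , refl | b , b∈ , refl | c , c∈ , refl =
      collinear (Unique.map⁻ u) (All.lookup (a∈ ∷ b∈ ∷ c∈ ∷ []))
                (Equivalence.from (collinear-image a b c) col)
    backward (parallelogram u S⊆FX par)
      with ∈-map⁻ F (S⊆FX (here refl)) | ∈-map⁻ F (S⊆FX (there (here refl)))
         | ∈-map⁻ F (S⊆FX (there (there (here refl)))) | ∈-map⁻ F (S⊆FX (there (there (there (here refl)))))
    ... | a , a∈ , refl | b , b∈ , refl | c , c∈ , refl | d , d∈ , refl =
      parallelogram (Unique.map⁻ u) (All.lookup (a∈ ∷ b∈ ∷ c∈ ∷ d∈ ∷ []))
                    (Equivalence.from (parallelogram-image a b c d) par)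

  twoCap-image : ∀ X → TwoCap X → TwoCap (List.map F X)
  twoCap-image X cap = noObstruction⇒twoCap (Unique.map⁺ F-injective (proj₁ cap))
    (twoCap⇒noObstruction cap ∘ Equivalence.from (obstruction-image X))

e₁ e₂ e₃ : Pt 3
e₁ = 1F ∷ 0F ∷ 0F ∷ []
e₂ = 0F ∷ 1F ∷ 0F ∷ []
e₃ = 0F ∷ 0F ∷ 1F ∷ []

columns : Pt 3 → Pt 3 → Pt 3 → Mat 3
columns (a₁ ∷ a₂ ∷ a₃ ∷ []) (b₁ ∷ b₂ ∷ b₃ ∷ []) (c₁ ∷ c₂ ∷ c₃ ∷ []) =
  (a₁ ∷ b₁ ∷ c₁ ∷ []) ∷ (a₂ ∷ b₂ ∷ c₂ ∷ []) ∷ (a₃ ∷ b₃ ∷ c₃ ∷ []) ∷ []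

pointwise₃ : ∀ {a b c a′ b′ c′ : F3} → a ≡ a′ → b ≡ b′ → c ≡ c′ →
             _≡_ {A = Pt 3} (a ∷ b ∷ c ∷ []) (a′ ∷ b′ ∷ c′ ∷ [])
pointwise₃ refl refl refl = refl

apply-columns : ∀ (a b c : Pt 3) x y z →
                apply (columns a b c) (x ∷ y ∷ z ∷ []) ≡ (x · a) ⊕ ((y · b) ⊕ (z · c))
apply-columns (a₁ ∷ a₂ ∷ a₃ ∷ []) (b₁ ∷ b₂ ∷ b₃ ∷ []) (c₁ ∷ c₂ ∷ c₃ ∷ []) x y z =
  pointwise₃ (row a₁ b₁ c₁) (row a₂ b₂ c₂) (row a₃ b₃ c₃)
  where
  row : ∀ a b c → a *₃ x +₃ (b *₃ y +₃ (c *₃ z +₃ 0F)) ≡ x *₃ a +₃ (y *₃ b +₃ z *₃ c)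
  row a b c = identity 6 (λ a b c x y z → a *₃ x +₃ (b *₃ y +₃ (c *₃ z +₃ 0F)))
                         (λ a b c x y z → x *₃ a +₃ (y *₃ b +₃ z *₃ c)) (a ∷ b ∷ c ∷ x ∷ y ∷ z ∷ [])

basis-expansion : ∀ (x y z : F3) → (x ∷ y ∷ z ∷ []) ≡ (x · e₁) ⊕ ((y · e₂) ⊕ (z · e₃))
basis-expansion x y z = pointwise₃
  (identity 3 (λ x y z → x) (λ x y z → x *₃ 1F +₃ (y *₃ 0F +₃ z *₃ 0F)) (x ∷ y ∷ z ∷ []))
  (identity 3 (λ x y z → y) (λ x y z → x *₃ 0F +₃ (y *₃ 1F +₃ z *₃ 0F)) (x ∷ y ∷ z ∷ []))
  (identity 3 (λ x y z → z) (λ x y z → x *₃ 0F +₃ (y *₃ 0F +₃ z *₃ 1F)) (x ∷ y ∷ z ∷ []))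

matrixOf : (Pt 3 → Pt 3) → Mat 3
matrixOf g = columns (g e₁) (g e₂) (g e₃)

apply-matrixOf : ∀ {g} → Linear g → ∀ v → apply (matrixOf g) v ≡ g v
apply-matrixOf {g} (additive , homogeneous) (x ∷ y ∷ z ∷ []) = begin
  apply (matrixOf g) (x ∷ y ∷ z ∷ [])              ≡⟨ apply-columns (g e₁) (g e₂) (g e₃) x y z ⟩
  (x · g e₁) ⊕ ((y · g e₂) ⊕ (z · g e₃))            ≡⟨ sym (cong₂ _⊕_ (homogeneous x e₁)
                                                         (cong₂ _⊕_ (homogeneous y e₂) (homogeneous z e₃))) ⟩
  g (x · e₁) ⊕ (g (y · e₂) ⊕ g (z · e₃))            ≡⟨ sym (trans (additive _ _)
                                                         (cong (g (x · e₁) ⊕_) (additive _ _))) ⟩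
  g ((x · e₁) ⊕ ((y · e₂) ⊕ (z · e₃)))              ≡⟨ cong g (sym (basis-expansion x y z)) ⟩
  g (x ∷ y ∷ z ∷ [])                                ∎
  where open ≡-Reasoning

invertible-fromSection : (M : Mat 3) → Injective _≡_ _≡_ (apply M) →
                         (M⁻¹ : Pt 3 → Pt 3) → (∀ y → apply M (M⁻¹ y) ≡ y) → Invertible M
invertible-fromSection M inj M⁻¹ section = matrixOf M⁻¹ , retraction , section′
  where
  M⁻¹-linear : Linear M⁻¹
  M⁻¹-linear = inverse-linear (apply-linear M) inj section
  retraction : ∀ v → apply (matrixOf M⁻¹) (apply M v) ≡ v
  retraction v = trans (apply-matrixOf M⁻¹-linear _) (inj (section (apply M v)))
  section′ : ∀ v → apply M (apply (matrixOf M⁻¹) v) ≡ v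
  section′ v = trans (cong (apply M) (apply-matrixOf M⁻¹-linear v)) (section v)

invertible : (M : Mat 3) → Injective _≡_ _≡_ (apply M) → Invertible M
invertible M inj =
  invertible-fromSection M inj (proj₁ ∘ surjective (apply M) inj) (proj₂ ∘ surjective (apply M) inj)

invertible-injective : ∀ {n} {A : Mat n} → Invertible A → Injective _≡_ _≡_ (apply A)
invertible-injective (B , retraction , _) {x} {y} eq =
  trans (sym (retraction x)) (trans (cong (apply B) eq) (retraction y))

MapsOnto : (Pt 3 → Pt 3) → List (Pt 3) → List (Pt 3) → Set
MapsOnto T C D = List.map T C ⊆ D × D ⊆ List.map T C

mapsOnto-∘ : ∀ {S T C D E} → MapsOnto S C D → MapsOnto T D E → MapsOnto (T ∘ S) C E
mapsOnto-∘ {S} {T} (SC⊆D , D⊆SC) (TD⊆E , E⊆TD) = forward , backward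
  where
  forward : List.map (T ∘ S) _ ⊆ _
  forward x∈ with ∈-map⁻ (T ∘ S) x∈
  ... | c , c∈ , refl = TD⊆E (∈-map⁺ T (SC⊆D (∈-map⁺ S c∈)))
  backward : _ ⊆ List.map (T ∘ S) _
  backward e∈ with ∈-map⁻ T (E⊆TD e∈)
  ... | d , d∈ , refl with ∈-map⁻ S (D⊆SC d∈)
  ...   | c , c∈ , refl = ∈-map⁺ (T ∘ S) c∈

mapsOnto-inverse : ∀ {S T C D} → (∀ x → T (S x) ≡ x) → MapsOnto S C D → MapsOnto T D C
mapsOnto-inverse {S} {T} {C} {D} TS≗id (SC⊆D , D⊆SC) = forward , backward
  where
  forward : List.map T D ⊆ C
  forward x∈ with ∈-map⁻ T x∈
  ... | d , d∈ , refl with ∈-map⁻ S (D⊆SC d∈)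
  ...   | c , c∈ , refl = subst (_∈ C) (sym (TS≗id c)) c∈
  backward : C ⊆ List.map T D
  backward {c} c∈ = subst (_∈ List.map T D) (TS≗id c) (∈-map⁺ T (SC⊆D (∈-map⁺ S c∈)))

affEquiv-via : ∀ {C D} (A : Mat 3) b → Invertible A → ∀ {T} → (∀ x → affine A b x ≡ T x) →
               MapsOnto T C D → AffEquiv C D
affEquiv-via {C} {D} A b inv {T} F≗T (TC⊆D , D⊆TC) =
  A , b , inv , subst (_⊆ D) (sym F[C]≡T[C]) TC⊆D , subst (D ⊆_) (sym F[C]≡T[C]) D⊆TC
  where F[C]≡T[C] = ListP.map-cong F≗T C

AffEquiv-sym : ∀ {C D} → AffEquiv C D → AffEquiv D C
AffEquiv-sym (A , b , inv@(B , retraction , section) , onto) =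
  affEquiv-via B (2F · apply B b) (A , section , retraction) (λ _ → refl) (mapsOnto-inverse inverse onto)
  where
  inverse : ∀ x → affine B (2F · apply B b) (affine A b x) ≡ x
  inverse x = trans (cong (_⊕ (2F · apply B b)) (proj₁ (apply-linear B) (apply A x) b))
                    (trans (⊕-⊖-cancel (apply B (apply A x)) (apply B b)) (retraction x))

AffEquiv-trans : ∀ {C D E} → AffEquiv C D → AffEquiv D E → AffEquiv C E
AffEquiv-trans (A₁ , b₁ , inv₁ , onto₁) (A₂ , b₂ , inv₂ , onto₂) =
  affEquiv-via A (apply A₂ b₁ ⊕ b₂) (invertible A A-injective) composite (mapsOnto-∘ onto₁ onto₂)
  where
  g = apply A₂ ∘ apply A₁
  g-linear = linear-∘ (apply-linear A₂) (apply-linear A₁)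
  A = matrixOf g
  additive₂ = proj₁ (apply-linear A₂)
  A-injective : Injective _≡_ _≡_ (apply A)
  A-injective eq = invertible-injective inv₁ (invertible-injective inv₂
                     (trans (sym (apply-matrixOf g-linear _)) (trans eq (apply-matrixOf g-linear _))))
  composite : ∀ x → affine A (apply A₂ b₁ ⊕ b₂) x ≡ affine A₂ b₂ (affine A₁ b₁ x)
  composite x = begin
    apply A x ⊕ (apply A₂ b₁ ⊕ b₂)              ≡⟨ cong (_⊕ (apply A₂ b₁ ⊕ b₂)) (apply-matrixOf g-linear x) ⟩
    g x ⊕ (apply A₂ b₁ ⊕ b₂)                    ≡⟨ sym (⊕-assoc (g x) (apply A₂ b₁) b₂) ⟩
    (g x ⊕ apply A₂ b₁) ⊕ b₂                    ≡⟨ cong (_⊕ b₂) (sym (additive₂ (apply A₁ x) b₁)) ⟩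
    apply A₂ (apply A₁ x ⊕ b₁) ⊕ b₂             ∎
    where open ≡-Reasoning

affEquiv-image : ∀ (M : Mat 3) o → Injective _≡_ _≡_ (apply M) → ∀ X → AffEquiv X (List.map (affine M o) X)
affEquiv-image M o inj X = M , o , invertible M inj , id , id

affine-columns-basis : ∀ (a b c o : Pt 3) →
  affine (columns a b c) o zeroV ≡ o × affine (columns a b c) o e₁ ≡ a ⊕ o ×
  affine (columns a b c) o e₂ ≡ b ⊕ o × affine (columns a b c) o e₃ ≡ c ⊕ o
affine-columns-basis a@(a₁ ∷ a₂ ∷ a₃ ∷ []) b@(b₁ ∷ b₂ ∷ b₃ ∷ []) c@(c₁ ∷ c₂ ∷ c₃ ∷ []) o =
  trans (cong (_⊕ o) (linear-zero (apply-linear (columns a b c)))) (⊕-identityˡ o) ,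
  cong (_⊕ o) (pointwise₃ (first a₁ b₁ c₁) (first a₂ b₂ c₂) (first a₃ b₃ c₃)) ,
  cong (_⊕ o) (pointwise₃ (second a₁ b₁ c₁) (second a₂ b₂ c₂) (second a₃ b₃ c₃)) ,
  cong (_⊕ o) (pointwise₃ (third a₁ b₁ c₁) (third a₂ b₂ c₂) (third a₃ b₃ c₃))
  where
  first : ∀ a b c → a *₃ 1F +₃ (b *₃ 0F +₃ (c *₃ 0F +₃ 0F)) ≡ a
  first a b c = identity 3 (λ a b c → a *₃ 1F +₃ (b *₃ 0F +₃ (c *₃ 0F +₃ 0F))) (λ a b c → a) (a ∷ b ∷ c ∷ [])
  second : ∀ a b c → a *₃ 0F +₃ (b *₃ 1F +₃ (c *₃ 0F +₃ 0F)) ≡ b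
  second a b c = identity 3 (λ a b c → a *₃ 0F +₃ (b *₃ 1F +₃ (c *₃ 0F +₃ 0F))) (λ a b c → b) (a ∷ b ∷ c ∷ [])
  third : ∀ a b c → a *₃ 0F +₃ (b *₃ 0F +₃ (c *₃ 1F +₃ 0F)) ≡ c
  third a b c = identity 3 (λ a b c → a *₃ 0F +₃ (b *₃ 0F +₃ (c *₃ 1F +₃ 0F))) (λ a b c → c) (a ∷ b ∷ c ∷ [])

identityMatrix : Mat 3
identityMatrix = columns e₁ e₂ e₃

frame₀ : List (Pt 3)
frame₀ = zeroV ∷ e₁ ∷ e₂ ∷ e₃ ∷ []

twoCap-by-check : (S : List (Pt 3)) →
                  {True (UniqueDec.unique? _≟ₚ_ S)} → {True (¬? (obstruction? S))} → TwoCap S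
twoCap-by-check S {unique} {free} = noObstruction⇒twoCap (toWitness unique) (toWitness free)

open DecMembership (_≟ₚ_ {3}) using (_∈?_)

completions : List (Pt 3)
completions = (1F ∷ 1F ∷ 1F ∷ []) ∷ (2F ∷ 2F ∷ 2F ∷ []) ∷
              (1F ∷ 2F ∷ 2F ∷ []) ∷ (2F ∷ 1F ∷ 2F ∷ []) ∷ (2F ∷ 2F ∷ 1F ∷ []) ∷ []

Std : List (Pt 3)
Std = frame₀ ++ (1F ∷ 1F ∷ 1F ∷ []) ∷ []

Completion : Pt 3 → Set
Completion y = Unique (frame₀ ++ y ∷ []) → ¬ Obstruction (frame₀ ++ y ∷ []) → y ∈ completions

completion : ∀ y → Completion y
completion = byExhaustion λ y → UniqueDec.unique? _≟ₚ_ _ →-dec ¬? (obstruction? _) →-dec y ∈? completions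

completions-clash : ∀ {y y′} → y ∈ completions → y′ ∈ completions → y ≢ y′ →
                    Obstruction (frame₀ ++ y ∷ y′ ∷ [])
completions-clash y∈ y′∈ = All.lookup (All.lookup clashes y∈) y′∈
  where
  clashes : All (λ y → All (λ y′ → y ≢ y′ → Obstruction (frame₀ ++ y ∷ y′ ∷ [])) completions) completions
  clashes = toWitness {a? = All.all? (λ y → All.all? (λ y′ → ¬? (y ≟ₚ y′) →-dec obstruction? _)
                                                     completions) completions} _

frame-dependency : ∀ {n} (y₁ y₂ y₃ : F3) (x₁ x₂ x₃ x₄ : Pt n) →
  ((2F *₃ (y₁ +₃ (y₂ +₃ y₃))) · x₁) ⊕ ((y₁ · x₂) ⊕ ((y₂ · x₃) ⊕ ((y₃ · x₄) ⊕ zeroV)))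
    ≡ (y₁ · (x₂ ⊖ x₁)) ⊕ ((y₂ · (x₃ ⊖ x₁)) ⊕ (y₃ · (x₄ ⊖ x₁)))
frame-dependency y₁ y₂ y₃ [] [] [] [] = refl
frame-dependency y₁ y₂ y₃ (a ∷ x₁) (b ∷ x₂) (c ∷ x₃) (d ∷ x₄) =
  cong₂ _∷_ (identity 7 (λ y₁ y₂ y₃ a b c d → (2F *₃ (y₁ +₃ (y₂ +₃ y₃))) *₃ a +₃
                                               (y₁ *₃ b +₃ (y₂ *₃ c +₃ (y₃ *₃ d +₃ 0F))))
                        (λ y₁ y₂ y₃ a b c d → y₁ *₃ (b +₃ 2F *₃ a) +₃
                                               (y₂ *₃ (c +₃ 2F *₃ a) +₃ y₃ *₃ (d +₃ 2F *₃ a)))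
                        (y₁ ∷ y₂ ∷ y₃ ∷ a ∷ b ∷ c ∷ d ∷ []))
            (frame-dependency y₁ y₂ y₃ x₁ x₂ x₃ x₄)

module Frame {x₁ x₂ x₃ x₄ : Pt 3} (independent : AffInd (List.lookup (x₁ ∷ x₂ ∷ x₃ ∷ x₄ ∷ []))) where

  M : Mat 3
  M = columns (x₂ ⊖ x₁) (x₃ ⊖ x₁) (x₄ ⊖ x₁)

  M-injective : Injective _≡_ _≡_ (apply M)
  M-injective = linear-injective (apply-linear M) kernel
    where
    -- M y ≡ zeroV says that (−(y₁ + y₂ + y₃), y₁, y₂, y₃) is an affine dependency of x₁, …, x₄.
    kernel : ∀ y → apply M y ≡ zeroV → y ≡ zeroV
    kernel (y₁ ∷ y₂ ∷ y₃ ∷ []) My≡0 = pointwise₃ (vanishes 1F) (vanishes 2F) (vanishes 3F)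
      where
      c : Fin 4 → F3
      c = Vec.lookup (2F *₃ (y₁ +₃ (y₂ +₃ y₃)) ∷ y₁ ∷ y₂ ∷ y₃ ∷ [])
      vanishes = independent c
        (identity 3 (λ y₁ y₂ y₃ → 2F *₃ (y₁ +₃ (y₂ +₃ y₃)) +₃ (y₁ +₃ (y₂ +₃ (y₃ +₃ 0F)))) (λ _ _ _ → 0F)
                    (y₁ ∷ y₂ ∷ y₃ ∷ []))
        (trans (frame-dependency y₁ y₂ y₃ x₁ x₂ x₃ x₄)
               (trans (sym (apply-columns (x₂ ⊖ x₁) (x₃ ⊖ x₁) (x₄ ⊖ x₁) y₁ y₂ y₃)) My≡0))

  open AffineImage M x₁ M-injective public

  image : ∀ ys → List.map F (frame₀ ++ ys) ≡ x₁ ∷ x₂ ∷ x₃ ∷ x₄ ∷ List.map F ys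
  image ys with affine-columns-basis (x₂ ⊖ x₁) (x₃ ⊖ x₁) (x₄ ⊖ x₁) x₁
  ... | F0 , F1 , F2 , F3′ =
    cong₂ _∷_ F0 (cong₂ _∷_ (trans F1 (⊖-⊕-cancel x₂ x₁)) (cong₂ _∷_ (trans F2 (⊖-⊕-cancel x₃ x₁))
                 (cong₂ _∷_ (trans F3′ (⊖-⊕-cancel x₄ x₁)) refl)))

  preimage : Pt 3 → Pt 3
  preimage x = proj₁ (surjective F F-injective x)

  preimage-section : ∀ x → F (preimage x) ≡ x
  preimage-section x = proj₂ (surjective F F-injective x)

  image-preimage : ∀ x → List.map F (frame₀ ++ preimage x ∷ []) ≡ x₁ ∷ x₂ ∷ x₃ ∷ x₄ ∷ x ∷ []
  image-preimage x = trans (image _) (cong (λ z → x₁ ∷ x₂ ∷ x₃ ∷ x₄ ∷ z ∷ []) (preimage-section x))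

  completes : ∀ {D} → TwoCap D → ∀ x → Unique (x₁ ∷ x₂ ∷ x₃ ∷ x₄ ∷ x ∷ []) →
              (x₁ ∷ x₂ ∷ x₃ ∷ x₄ ∷ x ∷ []) ⊆ D → preimage x ∈ completions
  completes cap x unique S⊆D =
    completion (preimage x) (Unique.map⁻ {f = F} (subst Unique (sym (image-preimage x)) unique))
      (twoCap⇒noObstruction cap ∘ Obstruction-mono S⊆D ∘ subst Obstruction (image-preimage x) ∘
       Equivalence.to (obstruction-image _))

no-six : ∀ {x₁ x₂ x₃ x₄ x₅ x₆ : Pt 3} {rest} → ¬ TwoCap (x₁ ∷ x₂ ∷ x₃ ∷ x₄ ∷ x₅ ∷ x₆ ∷ rest)
no-six {x₁} {x₂} {x₃} {x₄} {x₅} {x₆} cap@(unique , _) =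
  twoCap⇒noObstruction cap (Obstruction-mono (Sublist.lookup S⊑D)
    (subst Obstruction F[S] (Equivalence.to (obstruction-image _) clash)))
  where
  open Frame (prefix-independent cap)
  S⊑D = refl ∷ refl ∷ refl ∷ refl ∷ refl ∷ refl ∷ Sublist.minimum _
  S₅⊑D = refl ∷ refl ∷ refl ∷ refl ∷ refl ∷ Sublist.minimum _
  S₆⊑D = refl ∷ refl ∷ refl ∷ refl ∷ x₅ ∷ʳ refl ∷ Sublist.minimum _
  y₅∈ = completes cap x₅ (Unique-resp-⊑ S₅⊑D unique) (Sublist.lookup S₅⊑D)
  y₆∈ = completes cap x₆ (Unique-resp-⊑ S₆⊑D unique) (Sublist.lookup S₆⊑D)
  x₅≢x₆ : x₅ ≢ x₆
  x₅≢x₆ with Unique-resp-⊑ (x₁ ∷ʳ x₂ ∷ʳ x₃ ∷ʳ x₄ ∷ʳ refl ∷ refl ∷ Sublist.minimum _) unique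
  ... | (x₅≢x₆ ∷ []) ∷ _ = x₅≢x₆
  clash = completions-clash y₅∈ y₆∈ λ eq →
            x₅≢x₆ (trans (sym (preimage-section x₅)) (trans (cong F eq) (preimage-section x₆)))
  F[S] : List.map F (frame₀ ++ preimage x₅ ∷ preimage x₆ ∷ []) ≡ x₁ ∷ x₂ ∷ x₃ ∷ x₄ ∷ x₅ ∷ x₆ ∷ []
  F[S] = trans (image _) (cong₂ (λ z w → x₁ ∷ x₂ ∷ x₃ ∷ x₄ ∷ z ∷ w ∷ [])
                                (preimage-section x₅) (preimage-section x₆))

twoCap-bound : ∀ D → TwoCap D → length D ≤ 5
twoCap-bound []                            _   = z≤n
twoCap-bound (_ ∷ [])                      _   = s≤s z≤n
twoCap-bound (_ ∷ _ ∷ [])                  _   = s≤s (s≤s z≤n)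
twoCap-bound (_ ∷ _ ∷ _ ∷ [])              _   = s≤s (s≤s (s≤s z≤n))
twoCap-bound (_ ∷ _ ∷ _ ∷ _ ∷ [])          _   = s≤s (s≤s (s≤s (s≤s z≤n)))
twoCap-bound (_ ∷ _ ∷ _ ∷ _ ∷ _ ∷ [])      _   = s≤s (s≤s (s≤s (s≤s (s≤s z≤n))))
twoCap-bound (_ ∷ _ ∷ _ ∷ _ ∷ _ ∷ _ ∷ _)   cap = ⊥-elim (no-six cap)

Std-twoCap : TwoCap Std
Std-twoCap = twoCap-by-check Std

maximal⇒length≡5 : ∀ C → Maximal C → length C ≡ 5
maximal⇒length≡5 C (cap , largest) = ℕ.≤-antisym (twoCap-bound C cap) (largest Std Std-twoCap)

extension⇒incomplete : ∀ {n} {z : Pt n} {C} → TwoCap (z ∷ C) → ¬ (∀ D → TwoCap D → C ⊆ D → D ⊆ C)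
extension⇒incomplete {z = z} {C} cap@((z∉C ∷ _) , _) complete =
  All.lookup z∉C (complete (z ∷ C) cap there (here refl)) refl

extend-by : ∀ (M : Mat 3) o → Injective _≡_ _≡_ (apply M) → ∀ {S C} → TwoCap S →
            List.map (affine M o) S ≡ C → TwoCap C
extend-by M o inj {S} cap refl = AffineImage.twoCap-image M o inj S cap

BasisCompletion₁ : Pt 3 → Set
BasisCompletion₁ a = a ≢ zeroV →
  Any (λ uw → T (nonsingular (columns a (proj₁ uw) (proj₂ uw)))) ((e₂ , e₃) ∷ (e₁ , e₃) ∷ (e₁ , e₂) ∷ [])

basisCompletion₁ : ∀ a → BasisCompletion₁ a
basisCompletion₁ = byExhaustion λ a → ¬? (a ≟ₚ zeroV) →-dec Any.any? (λ _ → T? _) _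

BasisCompletion₂ : Pt 3 → Pt 3 → Set
BasisCompletion₂ a b = a ≢ zeroV → b ≢ zeroV → a ≢ b → a ⊕ b ≢ zeroV →
  Any (λ w → T (nonsingular (columns a b w))) (e₁ ∷ e₂ ∷ e₃ ∷ [])

basisCompletion₂ : ∀ a b → BasisCompletion₂ a b
basisCompletion₂ = byExhaustion₂ λ a b →
  ¬? (_ ≟ₚ _) →-dec ¬? (_ ≟ₚ _) →-dec ¬? (_ ≟ₚ _) →-dec ¬? (_ ≟ₚ _) →-dec Any.any? (λ _ → T? _) _

extension₂ : ∀ {x₁ x₂ : Pt 3} → x₁ ≢ x₂ → ∃ λ z → TwoCap (z ∷ x₁ ∷ x₂ ∷ [])
extension₂ {x₁} {x₂} x₁≢x₂ =
  _ , extend-by (columns a u w) x₁ (nonsingular-injective _ (proj₂ completed))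
                (twoCap-by-check (e₂ ∷ zeroV ∷ e₁ ∷ []))
                (cong₂ _∷_ refl (cong₂ _∷_ F0 (cong (_∷ []) (trans F1 (⊖-⊕-cancel x₂ x₁)))))
  where
  a = x₂ ⊖ x₁
  completed : ∃ λ uw → T (nonsingular (columns a (proj₁ uw) (proj₂ uw)))
  completed = Any.satisfied (basisCompletion₁ a (x₁≢x₂ ∘ sym ∘ ⊖≡zero⇒≡ x₂ x₁))
  u = proj₁ (proj₁ completed)
  w = proj₂ (proj₁ completed)
  F0 = proj₁ (affine-columns-basis a u w x₁)
  F1 = proj₁ (proj₂ (affine-columns-basis a u w x₁))

extension₃ : ∀ {x₁ x₂ x₃ : Pt 3} → TwoCap (x₁ ∷ x₂ ∷ x₃ ∷ []) →
             ∃ λ z → TwoCap (z ∷ x₁ ∷ x₂ ∷ x₃ ∷ [])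
extension₃ {x₁} {x₂} {x₃} cap@(((x₁≢x₂ ∷ x₁≢x₃ ∷ []) ∷ (x₂≢x₃ ∷ []) ∷ [] ∷ []) , _) =
  _ , extend-by (columns a b w) x₁ (nonsingular-injective _ (proj₂ completed))
                (twoCap-by-check (e₃ ∷ zeroV ∷ e₁ ∷ e₂ ∷ []))
                (cong₂ _∷_ refl (cong₂ _∷_ F0 (cong₂ _∷_ (trans F1 (⊖-⊕-cancel x₂ x₁))
                                                     (cong (_∷ []) (trans F2 (⊖-⊕-cancel x₃ x₁))))))
  where
  a = x₂ ⊖ x₁
  b = x₃ ⊖ x₁
  completed : ∃ λ w → T (nonsingular (columns a b w))
  completed = Any.satisfied (basisCompletion₂ a b
    (x₁≢x₂ ∘ sym ∘ ⊖≡zero⇒≡ x₂ x₁) (x₁≢x₃ ∘ sym ∘ ⊖≡zero⇒≡ x₃ x₁) (x₂≢x₃ ∘ ⊕-cancelʳ x₂ x₃ (2F · x₁))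
    (twoCap⇒noObstruction cap ∘ collinear (proj₁ cap) id ∘ collinear-differences x₁ x₂ x₃))
  w = proj₁ completed
  F0 = proj₁ (affine-columns-basis a b w x₁)
  F1 = proj₁ (proj₂ (affine-columns-basis a b w x₁))
  F2 = proj₁ (proj₂ (proj₂ (affine-columns-basis a b w x₁)))

extension : ∀ C → TwoCap C → length C ℕ.< 5 → ∃ λ z → TwoCap (z ∷ C)
extension [] _ _ = zeroV , twoCap-by-check _
extension (x₁ ∷ []) _ _ =
  _ , extend-by identityMatrix x₁ (nonsingular-injective identityMatrix _)
                (twoCap-by-check (e₁ ∷ zeroV ∷ []))
                (cong₂ _∷_ refl (cong (_∷ []) (proj₁ (affine-columns-basis e₁ e₂ e₃ x₁))))
extension (x₁ ∷ x₂ ∷ []) (((x₁≢x₂ ∷ []) ∷ _) , _) _ = extension₂ x₁≢x₂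
extension (x₁ ∷ x₂ ∷ x₃ ∷ []) cap _ = extension₃ cap
extension (x₁ ∷ x₂ ∷ x₃ ∷ x₄ ∷ []) cap _ =
  _ , extend-by M x₁ M-injective (twoCap-by-check ((1F ∷ 1F ∷ 1F ∷ []) ∷ frame₀))
                (cong₂ _∷_ refl (image []))
  where open Frame (prefix-independent cap)
extension (_ ∷ _ ∷ _ ∷ _ ∷ _ ∷ _) _ (s≤s (s≤s (s≤s (s≤s (s≤s ())))))

complete⇒maximal : ∀ C → Complete C → Maximal C
complete⇒maximal C (cap , complete) = cap , λ D capD → ℕ.≤-trans (twoCap-bound D capD) five≤|C|
  where
  five≤|C| : 5 ≤ length C
  five≤|C| with 5 ℕ.≤? length C
  ... | yes five≤ = five≤
  ... | no  short = ⊥-elim (extension⇒incomplete (proj₂ (extension C cap (ℕ.≰⇒> short))) complete)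

affEquiv-by-check : ∀ (A : Mat 3) b C D → {T (nonsingular A)} →
  {True (All.all? (_∈? D) (List.map (affine A b) C))} → {True (All.all? (_∈? List.map (affine A b) C) D)} →
  AffEquiv C D
affEquiv-by-check A b C D {nonsingular-A} {forward} {backward} =
  A , b , invertible A (nonsingular-injective A nonsingular-A) ,
  All.lookup (toWitness forward) , All.lookup (toWitness backward)

standard-form : ∀ {y} → y ∈ completions → AffEquiv Std (frame₀ ++ y ∷ [])
standard-form (here refl) = affEquiv-by-check identityMatrix zeroV Std _
standard-form (there (here refl)) = affEquiv-by-check
  ((0F ∷ 1F ∷ 2F ∷ []) ∷ (1F ∷ 0F ∷ 2F ∷ []) ∷ (2F ∷ 2F ∷ 1F ∷ []) ∷ []) e₃ Std _
standard-form (there (there (here refl))) = affEquiv-by-check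
  ((0F ∷ 0F ∷ 1F ∷ []) ∷ (0F ∷ 1F ∷ 2F ∷ []) ∷ (1F ∷ 0F ∷ 2F ∷ []) ∷ []) zeroV Std _
standard-form (there (there (there (here refl)))) = affEquiv-by-check
  ((0F ∷ 1F ∷ 2F ∷ []) ∷ (0F ∷ 0F ∷ 1F ∷ []) ∷ (1F ∷ 0F ∷ 2F ∷ []) ∷ []) zeroV Std _
standard-form (there (there (there (there (here refl))))) = affEquiv-by-check
  ((0F ∷ 1F ∷ 2F ∷ []) ∷ (1F ∷ 0F ∷ 2F ∷ []) ∷ (0F ∷ 0F ∷ 1F ∷ []) ∷ []) zeroV Std _

maximal⇒equivalent-Std : ∀ C → Maximal C → AffEquiv Std C
maximal⇒equivalent-Std C maximal@(cap , _) = go C cap (maximal⇒length≡5 C maximal)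
  where
  go : ∀ C → TwoCap C → length C ≡ 5 → AffEquiv Std C
  go (x₁ ∷ x₂ ∷ x₃ ∷ x₄ ∷ x₅ ∷ []) cap@(unique , _) _ =
    AffEquiv-trans (standard-form (completes cap x₅ unique id))
                   (subst (AffEquiv _) (image-preimage x₅) (affEquiv-image M x₁ M-injective _))
    where open Frame (prefix-independent cap)

theorem3p9 : (Σ (List (Pt 3)) (λ C → Maximal C × length C ≡ 5))
    × (∀ (C : List (Pt 3)) → Maximal C → length C ≡ 5)
    × (∀ (C : List (Pt 3)) → Complete C → Maximal C)
    × (∀ (C D : List (Pt 3)) → Maximal C → Maximal D → AffEquiv C D)
theorem3p9 =
  (Std , (Std-twoCap , twoCap-bound) , refl) ,
  maximal⇒length≡5 ,
  complete⇒maximal ,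
  λ C D maximal-C maximal-D →
    AffEquiv-trans (AffEquiv-sym (maximal⇒equivalent-Std C maximal-C)) (maximal⇒equivalent-Std D maximal-D)
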